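{- Let $r\geq 3$. Let $\mathcal{H}$ be an $r$-graph embeddable in a $1$-reducible $r$-tree, and let $S$ be a cross-cut of $\mathcal{H}$. Then $\mathcal{H}-S$ is embeddable in an $(r-1)$-tree whose vertex set equals the vertex set of $\mathcal{H}-S$.
   Context: An $r$-tree is an $r$-uniform hypergraph whose edges can be ordered $E_1,\dots,E_m$ so that for each $i>1$ there is $\alpha(i)<i$ with $E_i\cap\bigcup_{j<i}E_j\subseteq E_{\alpha(i)}$; it is $1$-reducible if each edge contains at least one vertex of degree $1$. Embeddable means isomorphic to a subgraph. A cross-cut is a vertex set containing exactly one vertex of each edge. $\mathcal{H}-S$ is the hypergraph $\{E\setminus S:E\in\mathcal{H}\}$ (duplicates removed) on $V(\mathcal{H})\setminus S$. -}

module Defs where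

open import Data.Nat using (ℕ; zero; suc; _<_; _≡ᵇ_)
open import Data.Bool using (Bool)
import Data.Bool as Bool
open import Data.Fin using (Fin; toℕ)
open import Data.Fin.Subset using (Subset; _∈_; _⊆_; _∩_; _─_; ⋃; ⁅_⁆; ∣_∣; ⊥)
open import Data.Fin.Subset.Properties using (_∈?_)
open import Data.List using (List; length; lookup; take; filter; map; allFin; deduplicate)
open import Data.List.Membership.Propositional using () renaming (_∈_ to _∈ˡ_)
open import Data.List.Relation.Unary.All using (All)
open import Data.List.Relation.Unary.Any using (Any)
open import Data.List.Relation.Unary.Unique.Propositional using (Unique)
open import Data.List.Relation.Binary.Permutation.Propositional using (_↭_)
open import Data.Vec.Properties using (≡-dec)
open import Data.Product using (Σ; ∃; _×_)
open import Relation.Binary.PropositionalEquality using (_≡_)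

Hypergraph : ℕ → Set
Hypergraph n = List (Subset n)

V : ∀ {n} → Hypergraph n → Subset n
V H = ⋃ H

IsRGraph : ∀ {n} → ℕ → Hypergraph n → Set
IsRGraph r H = Unique H × All (λ E → ∣ E ∣ ≡ r) H

-- The edge order E₁,…,Eₘ given by the list satisfies the tree condition:
-- for every i > 1 there is α(i) < i with Eᵢ ∩ ⋃_{j<i} Eⱼ ⊆ E_{α(i)}.
TreeOrder : ∀ {n} → List (Subset n) → Set
TreeOrder L = ∀ (i : Fin (length L)) → 0 < toℕ i →
  Σ (Fin (length L)) λ a → (toℕ a < toℕ i) ×
    ((lookup L i ∩ ⋃ (take (toℕ i) L)) ⊆ lookup L a)

IsRTree : ∀ {n} → ℕ → Hypergraph n → Set
IsRTree r T = IsRGraph r T × Σ (List (Subset _)) λ L → (L ↭ T) × TreeOrder L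

degree : ∀ {n} → Hypergraph n → Fin n → ℕ
degree H v = length (filter (v ∈?_) H)

OneReducible : ∀ {n} → Hypergraph n → Set
OneReducible H = All (λ E → ∃ λ v → v ∈ E × degree H v ≡ 1) H

image : ∀ {n m} → (Fin n → Fin m) → Subset n → Subset m
image {n} f E = ⋃ (map (λ v → ⁅ f v ⁆) (filter (_∈? E) (allFin n)))

Embeddable : ∀ {n m} → Hypergraph n → Hypergraph m → Set
Embeddable {n} {m} H G = Σ (Fin n → Fin m) λ f →
  (∀ u v → u ∈ V H → v ∈ V H → f u ≡ f v → u ≡ v) ×
  All (λ E → image f E ∈ˡ G) H

IsCrossCut : ∀ {n} → Hypergraph n → Subset n → Set
IsCrossCut H S = S ⊆ V H × All (λ E → ∣ E ∩ S ∣ ≡ 1) H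

_minus_ : ∀ {n} → Hypergraph n → Subset n → Hypergraph n
H minus S = deduplicate (≡-dec Bool._≟_) (map (λ E → E ─ S) H)

VMinus : ∀ {n} → Hypergraph n → Subset n → Subset n
VMinus H S = V H ─ S

-- Put U = V(H) ∖ S and pull every edge Y of T back to its trace
-- U ∩ f⁻¹(Y).  Pulling back preserves the tree condition, the trace of the
-- image of an edge E of H is E ∖ S (of size r-1), and every other trace has
-- at most r-1 vertices: such a Y has a vertex of degree 1 that is missed by
-- f(U).  Moving an edge E₀ ∖ S to the front, we then walk along the traces
-- and enlarge each one, inside itself plus the enlargement of its parent, to
-- exactly r-1 vertices, discarding repetitions.  The result is an
-- (r-1)-tree on U that contains every E ∖ S, so the identity embeds H - S.
module Submission where

open import Defs
open import Data.Nat using (ℕ; _≤_; _∸_)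
open import Data.Fin.Subset using (Subset)
open import Data.Product using (Σ; _×_)
open import Relation.Binary.PropositionalEquality using (_≡_)

open import Data.Nat using (zero; suc; _+_; _<_; z≤n; s≤s; _≤?_)
open import Data.Nat.Properties using (+-suc; ≤-reflexive; ≤-antisym; ≰⇒>; <⇒≱)
import Data.Bool as Bool
open import Data.Fin using (Fin; zero; suc; toℕ)
open import Data.Fin.Properties using (0≢1+n; suc-injective)
open import Data.Fin.Subset
  using (_∈_; _∉_; _⊆_; _∩_; _∪_; _─_; _-_; ⋃; ⁅_⁆; ∣_∣; ⊥; inside; outside)
open import Data.Fin.Subset.Properties
  using ( _∈?_; ⊆-refl; ⊆-antisym; drop-∷-⊆; s⊆s; out⊆; in⊆in; ∉⊥; x∈⁅x⁆; x∈⁅y⁆⇒x≡y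
        ; ∣⁅x⁆∣≡1; p⊆q⇒∣p∣≤∣q∣; p∩q⊆q; x∈p∩q⁺; x∈p∩q⁻; p⊆p∪q; q⊆p∪q; x∈p∪q⁻
        ; ∣q∣≤∣p∪q∣; p─q⊆p; x∈p∧x∉q⇒x∈p─q; x∈p∧x≢y⇒x∈p-y )
open import Data.Vec using ([]; _∷_; tabulate; here; there)
import Data.Vec as Vec
open import Data.Vec.Properties using (≡-dec; lookup∘tabulate; lookup⇒[]=; []=⇒lookup)
open import Data.List using (List; []; _∷_; _++_; [_]; map; filter; allFin; length; lookup; take)
open import Data.List.Properties using (++-assoc; ++-identityʳ; map-++)
open import Data.List.Membership.Propositional using (find; lose) renaming (_∈_ to _∈ˡ_)
open import Data.List.Membership.Propositional.Properties
  using (∈-map⁺; ∈-map⁻; ∈-filter⁺; ∈-filter⁻; ∈-allFin; ∈-++⁺ʳ; ∈-++⁻; ∈-deduplicate⁻)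
import Data.List.Membership.DecPropositional as DecMembership
open import Data.List.Relation.Binary.Subset.Propositional using () renaming (_⊆_ to _⊆ˡ_)
import Data.List.Relation.Binary.Subset.Propositional.Properties as ⊆ˡ
open import Data.List.Relation.Unary.Any using (any?) renaming (here to lhere; there to lthere)
open import Data.List.Relation.Unary.All using (All; []; _∷_)
import Data.List.Relation.Unary.All as All
import Data.List.Relation.Unary.All.Properties as All
open import Data.List.Relation.Unary.AllPairs using ([]; _∷_)
open import Data.List.Relation.Unary.Unique.Propositional using (Unique)
import Data.List.Relation.Unary.Unique.Propositional.Properties as Unique
open import Data.List.Relation.Binary.Permutation.Propositional using (_↭_; ↭-refl; ↭-sym)
open import Data.List.Relation.Binary.Permutation.Propositional.Properties using (∈-resp-↭)
open import Data.Product using (_,_; proj₁; proj₂)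
open import Data.Sum using (_⊎_; inj₁; inj₂; [_,_]′)
open import Data.Unit using (⊤; tt)
open import Data.Empty using (⊥-elim) renaming (⊥ to Empty)
open import Function using (id)
open import Relation.Nullary using (¬_; Dec; yes; no)
open import Relation.Binary.PropositionalEquality using (refl; sym; trans; cong; subst; module ≡-Reasoning)
open ≡-Reasoning

private variable
  n m k : ℕ

x∈p─q⇒x∉q : ∀ {x : Fin n} (p q : Subset n) → x ∈ p ─ q → x ∉ q
x∈p─q⇒x∉q (_ ∷ p) (_ ∷ q) (there x∈p─q) (there x∈q) = x∈p─q⇒x∉q p q x∈p─q x∈q

x∈p─q⁻ : ∀ {x : Fin n} (p q : Subset n) → x ∈ p ─ q → x ∈ p × x ∉ q
x∈p─q⁻ p q x∈p─q = p─q⊆p p q x∈p─q , x∈p─q⇒x∉q p q x∈p─q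

∩-monoʳ : ∀ {p q q′ : Subset n} → q ⊆ q′ → p ∩ q ⊆ p ∩ q′
∩-monoʳ {p = p} {q} q⊆q′ x∈ = let (x∈p , x∈q) = x∈p∩q⁻ p q x∈ in x∈p∩q⁺ (x∈p , q⊆q′ x∈q)

⊆⋃ : ∀ {x} {xs : List (Subset n)} → x ∈ˡ xs → x ⊆ ⋃ xs
⊆⋃ {xs = y ∷ ys} (lhere refl) = p⊆p∪q (⋃ ys)
⊆⋃ {xs = y ∷ ys} (lthere x∈ys) v∈x = q⊆p∪q y (⋃ ys) (⊆⋃ x∈ys v∈x)

∈⋃⁻ : ∀ {v : Fin n} (xs : List (Subset n)) → v ∈ ⋃ xs → Σ (Subset n) λ w → w ∈ˡ xs × v ∈ w
∈⋃⁻ [] v∈ = ⊥-elim (∉⊥ v∈)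
∈⋃⁻ (w ∷ ws) v∈ with x∈p∪q⁻ w (⋃ ws) v∈
... | inj₁ v∈w = w , lhere refl , v∈w
... | inj₂ v∈ws = let (w′ , w′∈ , v∈w′) = ∈⋃⁻ ws v∈ws in w′ , lthere w′∈ , v∈w′

⋃-mono : ∀ {xs ys : List (Subset n)} → xs ⊆ˡ ys → ⋃ xs ⊆ ⋃ ys
⋃-mono {xs = xs} xs⊆ys v∈ = let (w , w∈ , v∈w) = ∈⋃⁻ xs v∈ in ⊆⋃ (xs⊆ys w∈) v∈w

∣p∣≡∣p∩q∣+∣p─q∣ : (p q : Subset n) → ∣ p ∣ ≡ ∣ p ∩ q ∣ + ∣ p ─ q ∣
∣p∣≡∣p∩q∣+∣p─q∣ [] [] = refl
∣p∣≡∣p∩q∣+∣p─q∣ (inside ∷ p) (inside ∷ q) = cong suc (∣p∣≡∣p∩q∣+∣p─q∣ p q)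
∣p∣≡∣p∩q∣+∣p─q∣ (inside ∷ p) (outside ∷ q) =
  trans (cong suc (∣p∣≡∣p∩q∣+∣p─q∣ p q)) (sym (+-suc _ _))
∣p∣≡∣p∩q∣+∣p─q∣ (outside ∷ p) (inside ∷ q) = ∣p∣≡∣p∩q∣+∣p─q∣ p q
∣p∣≡∣p∩q∣+∣p─q∣ (outside ∷ p) (outside ∷ q) = ∣p∣≡∣p∩q∣+∣p─q∣ p q

∣p∣≡1+∣p-x∣ : ∀ {x : Fin n} (p : Subset n) → x ∈ p → ∣ p ∣ ≡ suc ∣ p - x ∣
∣p∣≡1+∣p-x∣ {x = x} p x∈p =
  trans (∣p∣≡∣p∩q∣+∣p─q∣ p ⁅ x ⁆) (cong (_+ ∣ p - x ∣) (trans (cong ∣_∣ p∩⁅x⁆≡⁅x⁆) (∣⁅x⁆∣≡1 x)))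
  where
  p∩⁅x⁆≡⁅x⁆ : p ∩ ⁅ x ⁆ ≡ ⁅ x ⁆
  p∩⁅x⁆≡⁅x⁆ = ⊆-antisym (p∩q⊆q p ⁅ x ⁆)
    (λ v∈ → x∈p∩q⁺ (subst (_∈ p) (sym (x∈⁅y⁆⇒x≡y x v∈)) x∈p , v∈))

⊆-∣∣-≡ : ∀ {p q : Subset n} → p ⊆ q → ∣ q ∣ ≤ ∣ p ∣ → p ≡ q
⊆-∣∣-≡ {p = []} {[]} _ _ = refl
⊆-∣∣-≡ {p = outside ∷ p} {outside ∷ q} p⊆q q≤p = cong (outside ∷_) (⊆-∣∣-≡ (drop-∷-⊆ p⊆q) q≤p)
⊆-∣∣-≡ {p = outside ∷ p} {inside ∷ q} p⊆q q<p = ⊥-elim (<⇒≱ q<p (p⊆q⇒∣p∣≤∣q∣ (drop-∷-⊆ p⊆q)))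
⊆-∣∣-≡ {p = inside ∷ p} {outside ∷ q} p⊆q _ with p⊆q here
... | ()
⊆-∣∣-≡ {p = inside ∷ p} {inside ∷ q} p⊆q (s≤s q≤p) = cong (inside ∷_) (⊆-∣∣-≡ (drop-∷-⊆ p⊆q) q≤p)

pigeonhole : (A : Subset n) (B : Subset m) (f : Fin n → Fin m) →
  (∀ {x} → x ∈ A → f x ∈ B) → (∀ {x y} → x ∈ A → y ∈ A → f x ≡ f y → x ≡ y) → ∣ A ∣ ≤ ∣ B ∣
pigeonhole [] B f _ _ = z≤n
pigeonhole (outside ∷ A) B f into inj =
  pigeonhole A B (λ x → f (suc x)) (λ x∈ → into (there x∈))
    (λ x∈ y∈ e → suc-injective (inj (there x∈) (there y∈) e))
pigeonhole (inside ∷ A) B f into inj =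
  subst (suc ∣ A ∣ ≤_) (sym (∣p∣≡1+∣p-x∣ B (into here)))
    (s≤s (pigeonhole A (B - f zero) (λ x → f (suc x)) into′
      (λ x∈ y∈ e → suc-injective (inj (there x∈) (there y∈) e))))
  where
  into′ : ∀ {x} → x ∈ A → f (suc x) ∈ B - f zero
  into′ x∈ = x∈p∧x≢y⇒x∈p-y (into (there x∈)) (λ e → 0≢1+n (sym (inj (there x∈) here e)))

pad : (A D : Subset n) (k : ℕ) → A ⊆ D → ∣ A ∣ ≤ k → k ≤ ∣ D ∣ →
      Σ (Subset n) λ C → A ⊆ C × C ⊆ D × ∣ C ∣ ≡ k
pad [] [] zero _ _ _ = [] , ⊆-refl , ⊆-refl , refl
pad [] [] (suc k) _ _ ()
pad (inside ∷ A) (_ ∷ D) zero _ () _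
pad (inside ∷ A) (outside ∷ D) (suc k) A⊆D _ _ with A⊆D here
... | ()
pad (inside ∷ A) (inside ∷ D) (suc k) A⊆D (s≤s A≤k) (s≤s k≤D) =
  let (C , A⊆C , C⊆D , ∣C∣≡k) = pad A D k (drop-∷-⊆ A⊆D) A≤k k≤D
  in inside ∷ C , in⊆in A⊆C , in⊆in C⊆D , cong suc ∣C∣≡k
pad (outside ∷ A) (outside ∷ D) k A⊆D A≤k k≤D =
  let (C , A⊆C , C⊆D , ∣C∣≡k) = pad A D k (drop-∷-⊆ A⊆D) A≤k k≤D
  in outside ∷ C , s⊆s A⊆C , s⊆s C⊆D , ∣C∣≡k
pad (outside ∷ A) (inside ∷ D) k A⊆D A≤k k≤1+D with k ≤? ∣ D ∣
... | yes k≤D =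
  let (C , A⊆C , C⊆D , ∣C∣≡k) = pad A D k (drop-∷-⊆ A⊆D) A≤k k≤D
  in outside ∷ C , s⊆s A⊆C , out⊆ C⊆D , ∣C∣≡k
... | no k≰D = inside ∷ D , out⊆ (drop-∷-⊆ A⊆D) , ⊆-refl , ≤-antisym (≰⇒> k≰D) k≤1+D

∈image⁺ : (f : Fin n → Fin m) {E : Subset n} {u : Fin n} → u ∈ E → f u ∈ image f E
∈image⁺ f {E} {u} u∈E =
  ⊆⋃ (∈-map⁺ (λ v → ⁅ f v ⁆) (∈-filter⁺ (_∈? E) (∈-allFin u) u∈E)) (x∈⁅x⁆ (f u))

∈image⁻ : (f : Fin n → Fin m) {E : Subset n} {y : Fin m} →
          y ∈ image f E → Σ (Fin n) λ u → u ∈ E × f u ≡ y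
∈image⁻ {n} f {E} y∈ with ∈⋃⁻ (map (λ v → ⁅ f v ⁆) (filter (_∈? E) (allFin n))) y∈
... | w , w∈ , y∈w with ∈-map⁻ (λ v → ⁅ f v ⁆) w∈
...   | u , u∈ , refl = u , proj₂ (∈-filter⁻ (_∈? E) {xs = allFin n} u∈) , sym (x∈⁅y⁆⇒x≡y (f u) y∈w)

image-id : (E : Subset n) → image id E ≡ E
image-id E = ⊆-antisym (λ y∈ → let (u , u∈E , u≡y) = ∈image⁻ id y∈ in subst (_∈ E) u≡y u∈E)
                       (∈image⁺ id)

length≡1⇒same : ∀ {A : Set} {a b : A} {xs : List A} → length xs ≡ 1 → a ∈ˡ xs → b ∈ˡ xs → a ≡ b
length≡1⇒same {xs = _ ∷ []} _ (lhere refl) (lhere refl) = refl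
length≡1⇒same {xs = _ ∷ []} _ (lthere ()) _
length≡1⇒same {xs = _ ∷ []} _ _ (lthere ())
length≡1⇒same {xs = _ ∷ _ ∷ _} () _ _

degree-one : ∀ {G : Hypergraph n} {p : Fin n} {a b : Subset n} → degree G p ≡ 1 →
             a ∈ˡ G → b ∈ˡ G → p ∈ a → p ∈ b → a ≡ b
degree-one {p = p} deg a∈ b∈ p∈a p∈b =
  length≡1⇒same deg (∈-filter⁺ (p ∈?_) a∈ p∈a) (∈-filter⁺ (p ∈?_) b∈ p∈b)

Attached : Subset n → List (Subset n) → Set
Attached {n} y xs = xs ≡ [] ⊎ Σ (Subset n) λ z → z ∈ˡ xs × y ∩ ⋃ xs ⊆ z

data TreeSeq {n : ℕ} : List (Subset n) → Set where
  nil  : TreeSeq []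
  snoc : ∀ {xs y} → TreeSeq xs → Attached y xs → TreeSeq (xs ++ [ y ])

attached-resp : ∀ {y : Subset n} {xs ys} → xs ⊆ˡ ys → ys ⊆ˡ xs → Attached y xs → Attached y ys
attached-resp {ys = []} _ _ _ = inj₁ refl
attached-resp {ys = _ ∷ _} _ ys⊆xs (inj₁ refl) = ⊥-elim (⊆ˡ.∷⊈[] ys⊆xs)
attached-resp xs⊆ys ys⊆xs (inj₂ (z , z∈ , y∩⊆z)) =
  inj₂ (z , xs⊆ys z∈ , λ v∈ → y∩⊆z (∩-monoʳ (⋃-mono ys⊆xs) v∈))

-- TreeSeq is built by appending, whereas TreeOrder accesses edges by index.
-- The two are related through the cons form Continues (L continues a tree
-- sequence begun by pre) and its indexed form Indexed.
Continues : List (Subset n) → List (Subset n) → Set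
Continues pre [] = ⊤
Continues pre (x ∷ xs) = Attached x pre × Continues (pre ++ [ x ]) xs

continues-snoc : ∀ {y : Subset n} pre xs → Continues pre xs → Attached y (pre ++ xs) →
                 Continues pre (xs ++ [ y ])
continues-snoc {y = y} pre [] _ y-att = subst (Attached y) (++-identityʳ pre) y-att , tt
continues-snoc {y = y} pre (x ∷ xs) (x-att , rest) y-att =
  x-att , continues-snoc (pre ++ [ x ]) xs rest (subst (Attached y) (sym (++-assoc pre [ x ] xs)) y-att)

treeSeq⇒continues : ∀ {xs : List (Subset n)} → TreeSeq xs → Continues [] xs
treeSeq⇒continues nil = tt
treeSeq⇒continues (snoc {xs} t y-att) = continues-snoc [] xs (treeSeq⇒continues t) y-att

continues⇒treeSeq : ∀ (pre xs : List (Subset n)) → TreeSeq pre → Continues pre xs → TreeSeq (pre ++ xs)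
continues⇒treeSeq pre [] t _ = subst TreeSeq (sym (++-identityʳ pre)) t
continues⇒treeSeq pre (x ∷ xs) t (x-att , rest) =
  subst TreeSeq (++-assoc pre [ x ] xs) (continues⇒treeSeq (pre ++ [ x ]) xs (snoc t x-att) rest)

Indexed : List (Subset n) → List (Subset n) → Set
Indexed pre L = ∀ i → Attached (lookup L i) (pre ++ take (toℕ i) L)

continues⇒indexed : ∀ (pre L : List (Subset n)) → Continues pre L → Indexed pre L
continues⇒indexed pre (x ∷ L) (x-att , _) zero = subst (Attached x) (sym (++-identityʳ pre)) x-att
continues⇒indexed pre (x ∷ L) (_ , rest) (suc i) =
  subst (Attached (lookup L i)) (++-assoc pre [ x ] (take (toℕ i) L))
    (continues⇒indexed (pre ++ [ x ]) L rest i)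

indexed⇒continues : ∀ (pre L : List (Subset n)) → Indexed pre L → Continues pre L
indexed⇒continues pre [] _ = tt
indexed⇒continues pre (x ∷ L) att =
  subst (Attached x) (++-identityʳ pre) (att zero) ,
  indexed⇒continues (pre ++ [ x ]) L
    (λ i → subst (Attached (lookup L i)) (sym (++-assoc pre [ x ] (take (toℕ i) L))) (att (suc i)))

take-index : ∀ (L : List (Subset n)) m {z} → z ∈ˡ take m L →
             Σ (Fin (length L)) λ a → toℕ a < m × lookup L a ≡ z
take-index (x ∷ L) (suc m) (lhere refl) = zero , s≤s z≤n , refl
take-index (x ∷ L) (suc m) (lthere z∈) =
  let (a , a<m , La≡z) = take-index L m z∈ in suc a , s≤s a<m , La≡z

index-take : ∀ (L : List (Subset n)) m (a : Fin (length L)) → toℕ a < m → lookup L a ∈ˡ take m L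
index-take (x ∷ L) (suc m) zero _ = lhere refl
index-take (x ∷ L) (suc m) (suc a) (s≤s a<m) = lthere (index-take L m a a<m)

indexed⇒treeOrder : ∀ (L : List (Subset n)) → Indexed [] L → TreeOrder L
indexed⇒treeOrder (x ∷ L) att (suc i) _ with att (suc i)
... | inj₂ (z , z∈ , sub) =
  let (a , a<i , La≡z) = take-index (x ∷ L) (suc (toℕ i)) z∈
  in a , a<i , λ v∈ → subst (_ ∈_) (sym La≡z) (sub v∈)

treeOrder⇒indexed : ∀ (L : List (Subset n)) → TreeOrder L → Indexed [] L
treeOrder⇒indexed (x ∷ L) _ zero = inj₁ refl
treeOrder⇒indexed (x ∷ L) order (suc i) =
  let (a , a<i , sub) = order (suc i) (s≤s z≤n)
  in inj₂ (lookup (x ∷ L) a , index-take (x ∷ L) (suc (toℕ i)) a a<i , sub)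

treeSeq⇒treeOrder : ∀ {L : List (Subset n)} → TreeSeq L → TreeOrder L
treeSeq⇒treeOrder {L = L} t = indexed⇒treeOrder L (continues⇒indexed [] L (treeSeq⇒continues t))

treeOrder⇒treeSeq : ∀ {L : List (Subset n)} → TreeOrder L → TreeSeq L
treeOrder⇒treeSeq {L = L} order =
  continues⇒treeSeq [] L nil (indexed⇒continues [] L (treeOrder⇒indexed L order))

prepend : ∀ {y : Subset n} {ws} → TreeSeq ws →
          (∀ {z zs} → ws ≡ z ∷ zs → y ∩ ⋃ ws ⊆ z) → TreeSeq (y ∷ ws)
prepend nil _ = snoc nil (inj₁ refl)
prepend {y = y} (snoc {[]} {w} _ _) _ = snoc (snoc nil (inj₁ refl)) (inj₂ (y , lhere refl , w∩⋃[y]⊆y))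
  where
  w∩⋃[y]⊆y : w ∩ ⋃ [ y ] ⊆ y
  w∩⋃[y]⊆y v∈ with ∈⋃⁻ [ y ] (proj₂ (x∈p∩q⁻ w _ v∈))
  ... | _ , lhere refl , v∈y = v∈y
prepend {y = y} (snoc {x ∷ xs} {w} t (inj₂ (u , u∈ , w∩⊆u))) y∩⊆first =
  snoc (prepend t y∩⊆x) (inj₂ (u , lthere u∈ , w∩⊆u′))
  where
  y∩⊆x : ∀ {z zs} → x ∷ xs ≡ z ∷ zs → y ∩ ⋃ (x ∷ xs) ⊆ z
  y∩⊆x refl v∈ = y∩⊆first refl (∩-monoʳ (⋃-mono (⊆ˡ.xs⊆xs++ys (x ∷ xs) [ w ])) v∈)
  -- a vertex of w lying in y is in the old first edge x, hence in ⋃ (x ∷ xs)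
  w∩⊆u′ : w ∩ ⋃ (y ∷ x ∷ xs) ⊆ u
  w∩⊆u′ {v} v∈ with x∈p∩q⁻ w _ v∈
  ... | v∈w , v∈⋃ with x∈p∪q⁻ y (⋃ (x ∷ xs)) v∈⋃
  ...   | inj₂ v∈⋃xs = w∩⊆u (x∈p∩q⁺ (v∈w , v∈⋃xs))
  ...   | inj₁ v∈y = w∩⊆u (x∈p∩q⁺ (v∈w , p⊆p∪q (⋃ xs) v∈x))
    where
    v∈x : v ∈ x
    v∈x = y∩⊆first refl (x∈p∩q⁺ (v∈y , ⊆⋃ (∈-++⁺ʳ (x ∷ xs) (lhere refl)) v∈w))

_≋_ : List (Subset n) → List (Subset n) → Set
xs ≋ ys = xs ⊆ˡ ys × ys ⊆ˡ xs

-- If x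
-- lies in the prefix xs, reroot xs and append y again; if x is the last edge
-- y, reroot xs at the parent z of y and put y in front.
reroot : ∀ {xs : List (Subset n)} {x} → TreeSeq xs → x ∈ˡ xs →
         Σ (List (Subset n)) λ ys → TreeSeq (x ∷ ys) × (x ∷ ys) ≋ xs
reroot nil ()
reroot (snoc {xs} {y} t y-att) x∈ with ∈-++⁻ xs x∈
... | inj₁ x∈xs =
  let (ys , t′ , ⊆xs , xs⊆) = reroot t x∈xs
  in ys ++ [ y ] , snoc t′ (attached-resp xs⊆ ⊆xs y-att) , ⊆ˡ.++⁺ˡ [ y ] ⊆xs , ⊆ˡ.++⁺ˡ [ y ] xs⊆
... | inj₂ (lhere refl) with y-att
...   | inj₁ refl = [] , snoc nil (inj₁ refl) , ⊆ˡ.⊆-refl , ⊆ˡ.⊆-refl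
...   | inj₂ (z , z∈ , y∩⊆z) =
  let (zs , t′ , ⊆xs , xs⊆) = reroot t z∈
  in z ∷ zs ,
     prepend t′ (λ { refl v∈ → y∩⊆z (∩-monoʳ (⋃-mono ⊆xs) v∈) }) ,
     ⊆ˡ.∈-∷⁺ʳ (∈-++⁺ʳ xs (lhere refl)) (⊆ˡ.⊆-trans ⊆xs (⊆ˡ.xs⊆xs++ys xs [ y ])) ,
     λ w∈ → [ (λ w∈xs → lthere (xs⊆ w∈xs)) , (λ { (lhere refl) → lhere refl }) ]′ (∈-++⁻ xs w∈)

module Pullback (g : Fin n → Fin m) (U : Subset n) where

  pullback : Subset m → Subset n
  pullback Y = U ∩ tabulate (λ u → Vec.lookup Y (g u))

  ∈pullback⁻ : ∀ {Y u} → u ∈ pullback Y → u ∈ U × g u ∈ Y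
  ∈pullback⁻ {Y} {u} u∈ =
    let (u∈U , u∈tab) = x∈p∩q⁻ U _ u∈
    in u∈U , lookup⇒[]= (g u) Y (trans (sym (lookup∘tabulate _ u)) ([]=⇒lookup u∈tab))

  ∈pullback⁺ : ∀ {Y u} → u ∈ U → g u ∈ Y → u ∈ pullback Y
  ∈pullback⁺ {Y} {u} u∈U gu∈Y =
    x∈p∩q⁺ (u∈U , lookup⇒[]= u _ (trans (lookup∘tabulate _ u) ([]=⇒lookup gu∈Y)))

  ⋃-pullback : ∀ {u} xs → u ∈ ⋃ (map pullback xs) → g u ∈ ⋃ xs
  ⋃-pullback xs u∈ with ∈⋃⁻ (map pullback xs) u∈
  ... | _ , w∈ , u∈w with ∈-map⁻ pullback w∈
  ...   | w , w∈xs , refl = ⊆⋃ w∈xs (proj₂ (∈pullback⁻ u∈w))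

  attached-pullback : ∀ {y xs} → Attached y xs → Attached (pullback y) (map pullback xs)
  attached-pullback (inj₁ refl) = inj₁ refl
  attached-pullback {y} {xs} (inj₂ (z , z∈ , y∩⊆z)) = inj₂ (pullback z , ∈-map⁺ pullback z∈ , sub)
    where
    sub : pullback y ∩ ⋃ (map pullback xs) ⊆ pullback z
    sub v∈ with x∈p∩q⁻ (pullback y) _ v∈
    ... | v∈y , v∈⋃ with ∈pullback⁻ {y} v∈y
    ...   | v∈U , gv∈y = ∈pullback⁺ v∈U (y∩⊆z (x∈p∩q⁺ (gv∈y , ⋃-pullback xs v∈⋃)))

  treeSeq-pullback : ∀ {xs} → TreeSeq xs → TreeSeq (map pullback xs)
  treeSeq-pullback nil = nil
  treeSeq-pullback (snoc {xs} {y} t y-att) =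
    subst TreeSeq (sym (map-++ pullback xs [ y ])) (snoc (treeSeq-pullback t) (attached-pullback y-att))

record Uniformization (k : ℕ) (xs : List (Subset n)) : Set where
  field
    edges    : List (Subset n)
    tree     : TreeSeq edges
    uniform  : All (λ e → ∣ e ∣ ≡ k) edges
    distinct : Unique edges
    within   : ⋃ edges ⊆ ⋃ xs
    covered  : ∀ {F} → F ∈ˡ xs → Σ (Subset n) λ e → e ∈ˡ edges × F ⊆ e
    kept     : ∀ {F} → F ∈ˡ xs → ∣ F ∣ ≡ k → F ∈ˡ edges

single : ∀ {y : Subset n} → ∣ y ∣ ≡ k → Uniformization k [ y ]
single {y = y} ∣y∣≡k = record
  { edges = [ y ] ; tree = snoc nil (inj₁ refl) ; uniform = ∣y∣≡k ∷ [] ; distinct = [] ∷ []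
  ; within = id ; covered = λ { (lhere refl) → y , lhere refl , id }
  ; kept = λ { (lhere refl) _ → lhere refl } }

module Extension {xs : List (Subset n)} {y e C : Subset n} (W : Uniformization k xs)
  (e∈ : e ∈ˡ Uniformization.edges W) (y∩⊆e : y ∩ ⋃ xs ⊆ e)
  (y⊆C : y ⊆ C) (C⊆y∪e : C ⊆ y ∪ e) (∣C∣≡k : ∣ C ∣ ≡ k) where

  open Uniformization W

  ⋃xs⊆ : ⋃ xs ⊆ ⋃ (xs ++ [ y ])
  ⋃xs⊆ = ⋃-mono (⊆ˡ.xs⊆xs++ys xs [ y ])

  -- the members of xs ++ [ y ] are covered and kept by any edge list
  -- extending the old one and containing C; if ∣y∣ = k then C = y
  covered′ : ∀ {es} → edges ⊆ˡ es → C ∈ˡ es →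
             ∀ {F} → F ∈ˡ xs ++ [ y ] → Σ (Subset n) λ e′ → e′ ∈ˡ es × F ⊆ e′
  covered′ ⊆es C∈ F∈ with ∈-++⁻ xs F∈
  ... | inj₁ F∈xs = let (e′ , e′∈ , F⊆e′) = covered F∈xs in e′ , ⊆es e′∈ , F⊆e′
  ... | inj₂ (lhere refl) = C , C∈ , y⊆C

  kept′ : ∀ {es} → edges ⊆ˡ es → C ∈ˡ es → ∀ {F} → F ∈ˡ xs ++ [ y ] → ∣ F ∣ ≡ k → F ∈ˡ es
  kept′ ⊆es C∈ F∈ ∣F∣≡k with ∈-++⁻ xs F∈
  ... | inj₁ F∈xs = ⊆es (kept F∈xs ∣F∣≡k)
  ... | inj₂ (lhere refl) =
    subst (_∈ˡ _) (sym (⊆-∣∣-≡ y⊆C (≤-reflexive (trans ∣C∣≡k (sym ∣F∣≡k))))) C∈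

  C∩⊆e : C ∩ ⋃ edges ⊆ e
  C∩⊆e v∈ with x∈p∩q⁻ C _ v∈
  ... | v∈C , v∈⋃ with x∈p∪q⁻ y e (C⊆y∪e v∈C)
  ...   | inj₁ v∈y = y∩⊆e (x∈p∩q⁺ (v∈y , within v∈⋃))
  ...   | inj₂ v∈e = v∈e

  grow : Dec (C ∈ˡ edges) → Uniformization k (xs ++ [ y ])
  grow (yes C∈) = record
    { edges = edges ; tree = tree ; uniform = uniform ; distinct = distinct
    ; within = λ v∈ → ⋃xs⊆ (within v∈)
    ; covered = covered′ ⊆ˡ.⊆-refl C∈ ; kept = kept′ ⊆ˡ.⊆-refl C∈ }
  grow (no C∉) = record
    { edges = edges ++ [ C ]
    ; tree = snoc tree (inj₂ (e , e∈ , C∩⊆e))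
    ; uniform = All.++⁺ uniform (∣C∣≡k ∷ [])
    ; distinct = Unique.++⁺ distinct ([] ∷ []) λ { (C′∈ , lhere refl) → C∉ C′∈ }
    ; within = within′
    ; covered = covered′ edges⊆ C∈′ ; kept = kept′ edges⊆ C∈′ }
    where
    edges⊆ : edges ⊆ˡ edges ++ [ C ]
    edges⊆ = ⊆ˡ.xs⊆xs++ys edges [ C ]
    C∈′ : C ∈ˡ edges ++ [ C ]
    C∈′ = ∈-++⁺ʳ edges (lhere refl)
    within′ : ⋃ (edges ++ [ C ]) ⊆ ⋃ (xs ++ [ y ])
    within′ v∈ with ∈⋃⁻ (edges ++ [ C ]) v∈
    ... | w , w∈ , v∈w with ∈-++⁻ edges w∈
    ...   | inj₁ w∈edges = ⋃xs⊆ (within (⊆⋃ w∈edges v∈w))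
    ...   | inj₂ (lhere refl) with x∈p∪q⁻ y e (C⊆y∪e v∈w)
    ...     | inj₁ v∈y = ⊆⋃ (∈-++⁺ʳ xs (lhere refl)) v∈y
    ...     | inj₂ v∈e = ⋃xs⊆ (within (⊆⋃ e∈ v∈e))

-- Pad y to k vertices inside y ∪ e, where e is an edge covering the parent
-- a of y; this is possible because ∣e∣ = k.
extend : ∀ {xs : List (Subset n)} {a y} → Uniformization k xs → a ∈ˡ xs → y ∩ ⋃ xs ⊆ a →
         ∣ y ∣ ≤ k → Uniformization k (xs ++ [ y ])
extend {k = k} {y = y} W a∈ y∩⊆a ∣y∣≤k with Uniformization.covered W a∈
... | e , e∈ , a⊆e with pad y (y ∪ e) k (p⊆p∪q e) ∣y∣≤k
                          (subst (_≤ ∣ y ∪ e ∣) (All.lookup (Uniformization.uniform W) e∈) (∣q∣≤∣p∪q∣ y e))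
...   | C , y⊆C , C⊆y∪e , ∣C∣≡k =
  Extension.grow W e∈ (λ v∈ → a⊆e (y∩⊆a v∈)) y⊆C C⊆y∪e ∣C∣≡k
    (DecMembership._∈?_ (≡-dec Bool._≟_) C (Uniformization.edges W))

HeadSize : ℕ → List (Subset n) → Set
HeadSize k [] = Empty
HeadSize k (x ∷ _) = ∣ x ∣ ≡ k

uniformize : ∀ {xs : List (Subset n)} → TreeSeq xs → HeadSize k xs →
             All (λ F → ∣ F ∣ ≤ k) xs → Uniformization k xs
uniformize (snoc {[]} _ _) ∣y∣≡k _ = single ∣y∣≡k
uniformize (snoc {x ∷ xs} t (inj₂ (a , a∈ , y∩⊆a))) head small
  with All.++⁻ʳ (x ∷ xs) small
... | ∣y∣≤k ∷ [] = extend (uniformize t head (All.++⁻ˡ (x ∷ xs) small)) a∈ y∩⊆a ∣y∣≤k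

module Construction {r n m : ℕ} (H : Hypergraph n) (S : Subset n) (T : Hypergraph m)
  (H-uniform : All (λ E → ∣ E ∣ ≡ r) H) (S-cuts : All (λ E → ∣ E ∩ S ∣ ≡ 1) H)
  (T-uniform : All (λ Y → ∣ Y ∣ ≡ r) T) (T-reducible : OneReducible T)
  (f : Fin n → Fin m) (f-inj : ∀ u v → u ∈ V H → v ∈ V H → f u ≡ f v → u ≡ v)
  (f-edges : All (λ E → image f E ∈ˡ T) H) where

  U : Subset n
  U = VMinus H S

  open Pullback f U using (treeSeq-pullback)
    renaming (pullback to trace; ∈pullback⁻ to ∈trace⁻; ∈pullback⁺ to ∈trace⁺)

  U⊆VH : U ⊆ V H
  U⊆VH u∈ = proj₁ (x∈p─q⁻ (V H) S u∈)

  trace⊆U : ∀ Y → trace Y ⊆ U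
  trace⊆U Y u∈ = proj₁ (∈trace⁻ {Y} u∈)

  edge-size : ∀ {E} → E ∈ˡ H → ∣ E ─ S ∣ ≡ r ∸ 1
  edge-size {E} E∈ = sym (cong (_∸ 1) (begin
    r                     ≡⟨ sym (All.lookup H-uniform E∈) ⟩
    ∣ E ∣                 ≡⟨ ∣p∣≡∣p∩q∣+∣p─q∣ E S ⟩
    ∣ E ∩ S ∣ + ∣ E ─ S ∣ ≡⟨ cong (_+ ∣ E ─ S ∣) (All.lookup S-cuts E∈) ⟩
    suc ∣ E ─ S ∣         ∎))

  trace-image : ∀ {E} → E ∈ˡ H → trace (image f E) ≡ E ─ S
  trace-image {E} E∈ = ⊆-antisym to from
    where
    to : trace (image f E) ⊆ E ─ S
    to {u} u∈ with ∈trace⁻ {image f E} u∈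
    ... | u∈U , fu∈ with ∈image⁻ f fu∈ | x∈p─q⁻ (V H) S u∈U
    ...   | w , w∈E , fw≡fu | u∈VH , u∉S =
      x∈p∧x∉q⇒x∈p─q (subst (_∈ E) (f-inj w u (⊆⋃ E∈ w∈E) u∈VH fw≡fu) w∈E) u∉S
    from : E ─ S ⊆ trace (image f E)
    from u∈ with x∈p─q⁻ E S u∈
    ... | u∈E , u∉S = ∈trace⁺ (x∈p∧x∉q⇒x∈p─q (⊆⋃ E∈ u∈E) u∉S) (∈image⁺ f u∈E)

  -- If Y is not the image of an
  -- edge of H, its vertex p of degree one is not hit by f on U (the image of
  -- an edge of H through p would be Y), so f maps the trace into Y - p.
  trace-size : ∀ {Y} → Y ∈ˡ T → ∣ trace Y ∣ ≤ r ∸ 1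
  trace-size {Y} Y∈ with any? (λ E → ≡-dec Bool._≟_ (image f E) Y) H
  ... | yes is-image with find is-image
  ...   | E , E∈ , refl = ≤-reflexive (trans (cong ∣_∣ (trace-image E∈)) (edge-size E∈))
  trace-size {Y} Y∈ | no not-image with All.lookup T-reducible Y∈
  ... | p , p∈Y , deg-p =
    subst (∣ trace Y ∣ ≤_) ∣Y-p∣≡r-1
      (pigeonhole (trace Y) (Y - p) f into (λ x∈ y∈ → f-inj _ _ (U⊆VH (trace⊆U Y x∈)) (U⊆VH (trace⊆U Y y∈))))
    where
    ∣Y-p∣≡r-1 : ∣ Y - p ∣ ≡ r ∸ 1
    ∣Y-p∣≡r-1 = cong (_∸ 1) (trans (sym (∣p∣≡1+∣p-x∣ Y p∈Y)) (All.lookup T-uniform Y∈))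
    into : ∀ {u} → u ∈ trace Y → f u ∈ Y - p
    into {u} u∈ = x∈p∧x≢y⇒x∈p-y (proj₂ (∈trace⁻ {Y} u∈)) fu≢p
      where
      fu≢p : ¬ (f u ≡ p)
      fu≢p fu≡p with ∈⋃⁻ H (U⊆VH (trace⊆U Y u∈))
      ... | E , E∈ , u∈E = not-image (lose E∈ (degree-one deg-p (All.lookup f-edges E∈) Y∈
                              (subst (_∈ image f E) fu≡p (∈image⁺ f u∈E)) p∈Y))

  module _ {L : List (Subset m)} (L↭T : L ↭ T) where

    traces-small : All (λ F → ∣ F ∣ ≤ r ∸ 1) (map trace L)
    traces-small = All.tabulate λ F∈ → case-trace F∈
      where
      case-trace : ∀ {F} → F ∈ˡ map trace L → ∣ F ∣ ≤ r ∸ 1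
      case-trace F∈ with ∈-map⁻ trace F∈
      ... | Y , Y∈ , refl = trace-size (∈-resp-↭ L↭T Y∈)

    edge∈traces : ∀ {E} → E ∈ˡ H → E ─ S ∈ˡ map trace L
    edge∈traces E∈ =
      subst (_∈ˡ map trace L) (trace-image E∈) (∈-map⁺ trace (∈-resp-↭ (↭-sym L↭T) (All.lookup f-edges E∈)))

    ⋃traces⊆U : ⋃ (map trace L) ⊆ U
    ⋃traces⊆U v∈ with ∈⋃⁻ (map trace L) v∈
    ... | F , F∈ , v∈F with ∈-map⁻ trace F∈
    ...   | Y , _ , refl = trace⊆U Y v∈F

    -- Reroot the traces at E₀ ∖ S and uniformize them: the edges obtained
    -- form an (r-1)-tree on U that contains every E ∖ S.
    reduced-tree : ∀ {E₀} → TreeOrder L → E₀ ∈ˡ H →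
      Σ (Hypergraph n) λ T′ → IsRTree (r ∸ 1) T′ × V T′ ≡ U × Embeddable (H minus S) T′
    reduced-tree {E₀} order E₀∈ with reroot (treeSeq-pullback (treeOrder⇒treeSeq order)) (edge∈traces E₀∈)
    ... | ys , rerooted , ⊆traces , traces⊆ =
      edges , ((distinct , uniform) , edges , ↭-refl , treeSeq⇒treeOrder tree) ,
      ⊆-antisym (λ v∈ → ⋃traces⊆U (⋃-mono ⊆traces (within v∈))) U⊆⋃edges ,
      id , (λ _ _ _ _ u≡v → u≡v) , All.tabulate contains
      where
      W : Uniformization (r ∸ 1) ((E₀ ─ S) ∷ ys)
      W = uniformize rerooted (edge-size E₀∈) (All.tabulate λ F∈ → All.lookup traces-small (⊆traces F∈))
      open Uniformization W
      U⊆⋃edges : U ⊆ ⋃ edges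
      U⊆⋃edges u∈ with x∈p─q⁻ (V H) S u∈
      ... | u∈VH , u∉S with ∈⋃⁻ H u∈VH
      ...   | E , E∈ , u∈E with covered (traces⊆ (edge∈traces E∈))
      ...     | e , e∈ , E─S⊆e = ⊆⋃ e∈ (E─S⊆e (x∈p∧x∉q⇒x∈p─q u∈E u∉S))
      contains : ∀ {F} → F ∈ˡ H minus S → image id F ∈ˡ edges
      contains F∈ with ∈-map⁻ (λ E → E ─ S) (∈-deduplicate⁻ (≡-dec Bool._≟_) (map (λ E → E ─ S) H) F∈)
      ... | E , E∈ , refl =
        subst (_∈ˡ edges) (sym (image-id (E ─ S))) (kept (traces⊆ (edge∈traces E∈)) (edge-size E∈))

-- Proposition 5.10.  An empty H is handled by the empty tree; otherwise the
-- construction applies to any edge E₀ of H and any tree order of T.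
proposition5p10 : (r : ℕ) → 3 ≤ r → (n : ℕ) → (H : Hypergraph n) → (S : Subset n) →
    IsRGraph r H →
    Σ ℕ (λ m → Σ (Hypergraph m) λ T → IsRTree r T × OneReducible T × Embeddable H T) →
    IsCrossCut H S →
    Σ (Hypergraph n) λ T′ → IsRTree (r ∸ 1) T′ × V T′ ≡ VMinus H S × Embeddable (H minus S) T′
proposition5p10 r _ n [] S _ _ _ =
  [] , (([] , []) , [] , ↭-refl , λ ()) ,
  ⊆-antisym (λ v∈ → ⊥-elim (∉⊥ v∈)) (λ v∈ → ⊥-elim (∉⊥ (p─q⊆p ⊥ S v∈))) ,
  id , (λ _ _ _ _ u≡v → u≡v) , []
proposition5p10 r _ n H@(_ ∷ _) S (_ , H-uniform)
  (m , T , ((_ , T-uniform) , L , L↭T , order) , T-reducible , f , f-inj , f-edges) (_ , S-cuts) =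
  Construction.reduced-tree H S T H-uniform S-cuts T-uniform T-reducible f f-inj f-edges L↭T order (lhere refl)
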